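{- Let $A,B$ be finite sequences of integers and let $(S(i))_{i\ge0}$ be the ordered Markov sequences for $A$ and $B$. Let $k$ be a positive odd integer, set $k_1=k$, and suppose $i\ge2$ is an integer such that the numbers $k_j=\frac{k_{j-1}+1}{2}$, $j=2,\ldots,i$, are positive integers with $k_i$ even. Let $k_{i+1}=k_i/2$. Then \[ S(k)=\begin{cases} S(k_{i+1})^i\oplus S(a(k_{i+1})), & \text{if } k_i>2,\\ S(0)^i\oplus S(1), & \text{if } k_i=2,\end{cases} \] where $X^i$ denotes $X$ concatenated with itself $i$ times.
   Context: For finite sequences $X,Y$, $X\oplus Y$ denotes concatenation. For a triple $(X,Y,Z)$ of finite sequences put $\mathcal{L}(X,Y,Z)=(X,X\oplus Y,Y)$ and $\mathcal{R}(X,Y,Z)=(Y,Y\oplus Z,Z)$. Let $v=(A,A\oplus B,B)$. For $m\ge1$ the $2^m$ triples at depth $m$ are $\varepsilon_m(\cdots\varepsilon_1(v)\cdots)$ for words $(\varepsilon_1,\ldots,\varepsilon_m)\in\{\mathcal{L},\mathcal{R}\}^m$ ($\varepsilon_1$ applied first), listed in lexicographic order with $\mathcal{L}<\mathcal{R}$. The ordered Markov sequences are $S(0)=A$, $S(1)=B$, $S(2)=A\oplus B$, and for $m\ge1$, $1\le i\le2^m$, $S(2^m+i)$ is the middle component of the $i$-th triple at depth $m$. The sequence $(a(j))_{j\ge1}$: $a(1)=a(2)=1$ and, for $j>1$, $a(2j)=a(j)$, $a(2j-1)=j$. -}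

module Defs where

open import Data.Nat using (ℕ; zero; suc; _+_; _*_; _∸_; _/_; _%_)
open import Data.Integer using (ℤ)
open import Data.List using (List; []; _∷_; _++_; reverse)
open import Data.Bool using (Bool; true; false)
open import Data.Product using (_×_; _,_)

-- finite sequences of integers; ⊕ is list concatenation
Seq : Set
Seq = List ℤ

Triple : Set
Triple = Seq × Seq × Seq

opL : Triple → Triple
opL (X , Y , Z) = (X , X ++ Y , Y)

opR : Triple → Triple
opR (X , Y , Z) = (Y , Y ++ Z , Z)

step : Bool → Triple → Triple
step false t = opL t
step true  t = opR t

applyWord : List Bool → Triple → Triple
applyWord []       t = t
applyWord (e ∷ es) t = applyWord es (step e t)

middle : Triple → Seq
middle (_ , Y , _) = Y

-- binary digits of x, least significant first, with the leading 1 removed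
-- (fuel-based; fuel ≥ x suffices). For x = 2^m + r with r < 2^m this gives
-- the m-bit binary expansion of r, least significant first.
bitsTail : ℕ → ℕ → List Bool
bitsTail zero       x = []
bitsTail (suc fuel) zero = []
bitsTail (suc fuel) (suc zero) = []
bitsTail (suc fuel) x@(suc (suc _)) with x % 2
... | zero  = false ∷ bitsTail fuel (x / 2)
... | suc _ = true  ∷ bitsTail fuel (x / 2)

-- For n = 2^m + i with m ≥ 1, 1 ≤ i ≤ 2^m, the word of the i-th triple at depth m
-- (lexicographic order, L < R, ε₁ most significant) is the m-bit binary
-- expansion of i - 1, i.e. the binary expansion of n - 1 without its leading 1.
wordOf : ℕ → List Bool
wordOf n = reverse (bitsTail n (n ∸ 1))

S : Seq → Seq → ℕ → Seq
S A B zero             = A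
S A B (suc zero)       = B
S A B (suc (suc zero)) = A ++ B
S A B n@(suc (suc (suc _))) = middle (applyWord (wordOf n) (A , A ++ B , B))

-- the sequence a(j): a(1)=a(2)=1, a(2j)=a(j), a(2j-1)=j for j>1; a(0)=0 (unused)
aFuel : ℕ → ℕ → ℕ
aFuel zero       n = 0
aFuel (suc f) zero = 0
aFuel (suc f) (suc zero) = 1
aFuel (suc f) (suc (suc zero)) = 1
aFuel (suc f) n@(suc (suc (suc _))) with n % 2
... | zero  = aFuel f (n / 2)
... | suc _ = (n + 1) / 2

a : ℕ → ℕ
a n = aFuel n n

pow : Seq → ℕ → Seq
pow X zero    = []
pow X (suc i) = X ++ pow X i

{-# OPTIONS --safe #-}
-- Number the triples of the Markov tree in heap order: the root (A, A ⊕ B, B) is 1 and the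
-- triple numbered x has L-child 2x and R-child 2x + 1.  The triple numbered x ≥ 1 then has the
-- form (X, X ⊕ Z, Z) with middle S(x + 1) and third component S(a(x + 1)).  From
-- 2 k_j = k_{j-1} + 1 we get k − 1 = 2^(i−1) (k_i − 1), so triple k − 1 arises from triple
-- k_i − 1 by i − 1 steps L, and L^r (X, X ⊕ Z, Z) has middle X^(r+1) ⊕ Z.  Finally
-- k_i − 1 = 2 k_{i+1} − 1 is the R-child of triple k_{i+1} − 1, giving X = S(k_{i+1}) and
-- Z = S(a(k_{i+1})), unless k_i = 2, where it is the root with X = S(0), Z = S(1).
module Submission where

open import Defs
open import Data.Nat
  using (ℕ; zero; suc; _+_; _*_; _∸_; _^_; _≤_; _<_; _/_; _%_; z≤n; s≤s; s≤s⁻¹)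
open import Data.Nat.Properties
open import Data.Nat.DivMod using (m*n/n≡m; m*n%n≡0; [m+kn]%n≡m%n; +-distrib-/-∣ʳ; m/n<m)
open import Data.Nat.Divisibility using (divides-refl)
open import Data.Nat.GeneralisedArithmetic using (fold)
open import Data.Nat.Induction using (<-rec)
open import Data.Integer using (ℤ)
open import Data.List using (List; []; _∷_; _++_; reverse; [_])
open import Data.List.Properties using (++-assoc; unfold-reverse)
open import Data.Bool using (true; false)
open import Data.Product using (_×_; Σ; _,_; proj₁; proj₂)
open import Data.Empty using (⊥-elim)
open import Relation.Nullary using (¬_)
open import Function using (_∘_)
open import Relation.Binary.PropositionalEquality
  using (_≡_; refl; sym; trans; cong; cong₂; subst; module ≡-Reasoning)
open ≡-Reasoning

data HalfView : ℕ → Set where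
  even : ∀ m → HalfView (m * 2)
  odd  : ∀ m → HalfView (suc (m * 2))

halfView : ∀ x → HalfView x
halfView zero = even 0
halfView (suc zero) = odd 0
halfView (suc (suc x)) with halfView x
... | even m = even (suc m)
... | odd m  = odd (suc m)

[1+m*2]/2≡m : ∀ m → suc (m * 2) / 2 ≡ m
[1+m*2]/2≡m m = trans (+-distrib-/-∣ʳ 1 {m * 2} {2} (divides-refl m)) (m*n/n≡m m 2)

halve-fuel : ∀ {y f} → suc (suc y) ≤ suc f → suc (suc y) / 2 ≤ f
halve-fuel {y} x≤1+f = s≤s⁻¹ (<-≤-trans (m/n<m (suc (suc y)) 2 (s≤s (s≤s z≤n))) x≤1+f)

bitsTail-fuel : ∀ {f g} x → x ≤ f → x ≤ g → bitsTail f x ≡ bitsTail g x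
bitsTail-fuel {zero}  {zero}  zero _ _ = refl
bitsTail-fuel {zero}  {suc g} zero _ _ = refl
bitsTail-fuel {suc f} {zero}  zero _ _ = refl
bitsTail-fuel {suc f} {suc g} zero _ _ = refl
bitsTail-fuel {suc f} {suc g} (suc zero) _ _ = refl
bitsTail-fuel {suc f} {suc g} x@(suc (suc _)) x≤f x≤g with x % 2
... | zero  = cong (false ∷_) (bitsTail-fuel (x / 2) (halve-fuel x≤f) (halve-fuel x≤g))
... | suc _ = cong (true ∷_)  (bitsTail-fuel (x / 2) (halve-fuel x≤f) (halve-fuel x≤g))

aFuel-fuel : ∀ {f g} n → n ≤ f → n ≤ g → aFuel f n ≡ aFuel g n
aFuel-fuel {zero}  {zero}  zero _ _ = refl
aFuel-fuel {zero}  {suc g} zero _ _ = refl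
aFuel-fuel {suc f} {zero}  zero _ _ = refl
aFuel-fuel {suc f} {suc g} zero _ _ = refl
aFuel-fuel {suc f} {suc g} (suc zero) _ _ = refl
aFuel-fuel {suc f} {suc g} (suc (suc zero)) _ _ = refl
aFuel-fuel {suc f} {suc g} n@(suc (suc (suc _))) n≤f n≤g with n % 2
... | zero  = aFuel-fuel (n / 2) (halve-fuel n≤f) (halve-fuel n≤g)
... | suc _ = refl

bitsTail-even : ∀ f m → 1 ≤ m → bitsTail (suc f) (m * 2) ≡ false ∷ bitsTail f m
bitsTail-even f (suc m) _ rewrite m*n%n≡0 (suc m) 2 {{_}} | m*n/n≡m (suc m) 2 {{_}} = refl

bitsTail-odd : ∀ f m → 1 ≤ m → bitsTail (suc f) (suc (m * 2)) ≡ true ∷ bitsTail f m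
bitsTail-odd f (suc m) _ rewrite [m+kn]%n≡m%n 1 (suc m) 2 {{_}} | [1+m*2]/2≡m (suc m) = refl

a-odd : ∀ m → 1 ≤ m → a (suc (m * 2)) ≡ suc m
a-odd (suc m) _ rewrite [m+kn]%n≡m%n 1 (suc m) 2 {{_}} =
  trans (cong (_/ 2) (+-comm (suc (suc m * 2)) 1)) (m*n/n≡m (suc (suc m)) 2)

a-even : ∀ m → 1 ≤ m → a (suc m * 2) ≡ a (suc m)
a-even (suc m) _ rewrite m*n%n≡0 (suc (suc m)) 2 {{_}} | m*n/n≡m (suc (suc m)) 2 {{_}} =
  aFuel-fuel (suc (suc m)) (s≤s (s≤s (m≤n⇒m≤1+n (m≤m*n m 2)))) ≤-refl

∸1-halving-step : ∀ k k′ → 2 * k′ ≡ k + 1 → k ∸ 1 ≡ 2 * (k′ ∸ 1)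
∸1-halving-step k k′ 2k′≡k+1 = begin
  k ∸ 1          ≡⟨ cong (_∸ 2) (+-comm 1 k) ⟩
  (k + 1) ∸ 2    ≡⟨ cong (_∸ 2) 2k′≡k+1 ⟨
  2 * k′ ∸ 2     ≡⟨ *-distribˡ-∸ 2 k′ 1 ⟨
  2 * (k′ ∸ 1)   ∎

∸1-halving-chain : (kk : ℕ → ℕ) (d : ℕ) →
                   (∀ j → 2 ≤ j → j ≤ suc d → 2 * kk j ≡ kk (j ∸ 1) + 1) →
                   kk 1 ∸ 1 ≡ 2 ^ d * (kk (suc d) ∸ 1)
∸1-halving-chain kk zero    _     = sym (+-identityʳ _)
∸1-halving-chain kk (suc d) halve = begin
  kk 1 ∸ 1                         ≡⟨ ∸1-halving-chain kk d (λ j 2≤j j≤1+d → halve j 2≤j (m≤n⇒m≤1+n j≤1+d)) ⟩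
  2 ^ d * (kk (suc d) ∸ 1)         ≡⟨ cong (2 ^ d *_) (∸1-halving-step (kk (suc d)) (kk (2 + d)) last) ⟩
  2 ^ d * (2 * (kk (2 + d) ∸ 1))   ≡⟨ *-assoc (2 ^ d) 2 _ ⟨
  2 ^ d * 2 * (kk (2 + d) ∸ 1)     ≡⟨ cong (_* (kk (2 + d) ∸ 1)) (*-comm (2 ^ d) 2) ⟩
  2 ^ suc d * (kk (2 + d) ∸ 1)     ∎
  where
  last : 2 * kk (2 + d) ≡ kk (suc d) + 1
  last = halve (2 + d) (s≤s (s≤s z≤n)) ≤-refl

first : Triple → Seq
first (X , _ , _) = X

third : Triple → Seq
third (_ , _ , Z) = Z

Splits : Triple → Set
Splits (X , Y , Z) = Y ≡ X ++ Z

step-splits : ∀ e {t} → Splits t → Splits (step e t)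
step-splits false {X , _ , Z} refl = refl
step-splits true  {X , _ , Z} refl = refl

applyWord-splits : ∀ w {t} → Splits t → Splits (applyWord w t)
applyWord-splits []      split = split
applyWord-splits (e ∷ w) split = applyWord-splits w (step-splits e split)

applyWord-++ : ∀ v w t → applyWord (v ++ w) t ≡ applyWord w (applyWord v t)
applyWord-++ []      w t = refl
applyWord-++ (e ∷ v) w t = applyWord-++ v w (step e t)

opL-fold : ∀ r X Z → fold (X , X ++ Z , Z) opL r ≡ (X , pow X (suc r) ++ Z , pow X r ++ Z)
opL-fold zero    X Z = cong (λ P → (X , P , Z)) (sym (++-assoc X [] Z))
opL-fold (suc r) X Z rewrite opL-fold r X Z =
  cong (λ P → (X , P , pow X (suc r) ++ Z)) (sym (++-assoc X (pow X (suc r)) Z))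

middle-fold-opL : ∀ r t → Splits t → middle (fold t opL r) ≡ pow (first t) (suc r) ++ third t
middle-fold-opL r (X , _ , Z) refl = cong middle (opL-fold r X Z)

wordOf-even : ∀ m → 1 ≤ m → wordOf (suc (m * 2)) ≡ wordOf (suc m) ++ [ false ]
wordOf-even m 1≤m = begin
  reverse (bitsTail (suc (m * 2)) (m * 2))  ≡⟨ cong reverse (bitsTail-even (m * 2) m 1≤m) ⟩
  reverse (false ∷ bitsTail (m * 2) m)
    ≡⟨ cong (reverse ∘ (false ∷_)) (bitsTail-fuel m (m≤m*n m 2) (n≤1+n m)) ⟩
  reverse (false ∷ bitsTail (suc m) m)      ≡⟨ unfold-reverse false (bitsTail (suc m) m) ⟩
  wordOf (suc m) ++ [ false ]               ∎

wordOf-odd : ∀ m → 1 ≤ m → wordOf (suc (suc (m * 2))) ≡ wordOf (suc m) ++ [ true ]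
wordOf-odd m 1≤m = begin
  reverse (bitsTail (suc (suc (m * 2))) (suc (m * 2)))  ≡⟨ cong reverse (bitsTail-odd (suc (m * 2)) m 1≤m) ⟩
  reverse (true ∷ bitsTail (suc (m * 2)) m)
    ≡⟨ cong (reverse ∘ (true ∷_)) (bitsTail-fuel m (m≤n⇒m≤1+n (m≤m*n m 2)) (n≤1+n m)) ⟩
  reverse (true ∷ bitsTail (suc m) m)                   ≡⟨ unfold-reverse true (bitsTail (suc m) m) ⟩
  wordOf (suc m) ++ [ true ]                            ∎

module _ (A B : Seq) where

  root : Triple
  root = (A , A ++ B , B)

  tripleAt : ℕ → Triple
  tripleAt x = applyWord (wordOf (suc x)) root

  tripleAt-splits : ∀ x → Splits (tripleAt x)
  tripleAt-splits x = applyWord-splits (wordOf (suc x)) refl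

  tripleAt-even : ∀ m → 1 ≤ m → tripleAt (m * 2) ≡ opL (tripleAt m)
  tripleAt-even m 1≤m = begin
    applyWord (wordOf (suc (m * 2))) root        ≡⟨ cong (λ w → applyWord w root) (wordOf-even m 1≤m) ⟩
    applyWord (wordOf (suc m) ++ [ false ]) root ≡⟨ applyWord-++ (wordOf (suc m)) [ false ] root ⟩
    opL (tripleAt m)                             ∎

  tripleAt-odd : ∀ m → 1 ≤ m → tripleAt (suc (m * 2)) ≡ opR (tripleAt m)
  tripleAt-odd m 1≤m = begin
    applyWord (wordOf (suc (suc (m * 2)))) root ≡⟨ cong (λ w → applyWord w root) (wordOf-odd m 1≤m) ⟩
    applyWord (wordOf (suc m) ++ [ true ]) root  ≡⟨ applyWord-++ (wordOf (suc m)) [ true ] root ⟩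
    opR (tripleAt m)                             ∎

  middle-tripleAt : ∀ x → 1 ≤ x → middle (tripleAt x) ≡ S A B (suc x)
  middle-tripleAt (suc zero)    _ = refl
  middle-tripleAt (suc (suc _)) _ = refl

  third-tripleAt : ∀ x → 1 ≤ x → third (tripleAt x) ≡ S A B (a (suc x))
  third-tripleAt = <-rec _ go
    where
    go : ∀ x → (∀ {y} → y < x → 1 ≤ y → third (tripleAt y) ≡ S A B (a (suc y))) →
         1 ≤ x → third (tripleAt x) ≡ S A B (a (suc x))
    go x ih 1≤x with halfView x
    ... | even (suc m) = begin
      third (tripleAt (suc m * 2))   ≡⟨ cong third (tripleAt-even (suc m) (s≤s z≤n)) ⟩
      middle (tripleAt (suc m))      ≡⟨ middle-tripleAt (suc m) (s≤s z≤n) ⟩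
      S A B (suc (suc m))            ≡⟨ cong (S A B) (a-odd (suc m) (s≤s z≤n)) ⟨
      S A B (a (suc (suc m * 2)))    ∎
    ... | odd zero = refl
    ... | odd (suc m) = begin
      third (tripleAt (suc (suc m * 2)))  ≡⟨ cong third (tripleAt-odd (suc m) (s≤s z≤n)) ⟩
      third (tripleAt (suc m))            ≡⟨ ih (s≤s (s≤s (m≤n⇒m≤1+n (m≤m*n m 2)))) (s≤s z≤n) ⟩
      S A B (a (suc (suc m)))             ≡⟨ cong (S A B) (a-even (suc m) (s≤s z≤n)) ⟨
      S A B (a (suc (suc (suc m * 2))))   ∎

  tripleAt-2^r* : ∀ r x → 1 ≤ x → tripleAt (2 ^ r * x) ≡ fold (tripleAt x) opL r
  tripleAt-2^r* zero    x _   = cong tripleAt (+-identityʳ x)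
  tripleAt-2^r* (suc r) x 1≤x = begin
    tripleAt (2 ^ suc r * x)     ≡⟨ cong tripleAt (trans (*-assoc 2 (2 ^ r) x) (*-comm 2 (2 ^ r * x))) ⟩
    tripleAt (2 ^ r * x * 2)     ≡⟨ tripleAt-even (2 ^ r * x) (*-mono-≤ (m^n>0 2 r) 1≤x) ⟩
    opL (tripleAt (2 ^ r * x))   ≡⟨ cong opL (tripleAt-2^r* r x 1≤x) ⟩
    fold (tripleAt x) opL (suc r) ∎

  S-1+2^r* : ∀ r x → 1 ≤ x →
             S A B (suc (2 ^ r * x)) ≡ pow (first (tripleAt x)) (suc r) ++ third (tripleAt x)
  S-1+2^r* r x 1≤x = begin
    S A B (suc (2 ^ r * x))        ≡⟨ middle-tripleAt (2 ^ r * x) (*-mono-≤ (m^n>0 2 r) 1≤x) ⟨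
    middle (tripleAt (2 ^ r * x))  ≡⟨ cong middle (tripleAt-2^r* r x 1≤x) ⟩
    middle (fold (tripleAt x) opL r) ≡⟨ middle-fold-opL r (tripleAt x) (tripleAt-splits x) ⟩
    pow (first (tripleAt x)) (suc r) ++ third (tripleAt x) ∎

  S-1+2^r*odd : ∀ r m → 1 ≤ m →
                S A B (suc (2 ^ r * suc (m * 2))) ≡ pow (S A B (suc m)) (suc r) ++ S A B (a (suc m))
  S-1+2^r*odd r m 1≤m = begin
    S A B (suc (2 ^ r * suc (m * 2)))  ≡⟨ S-1+2^r* r (suc (m * 2)) (s≤s z≤n) ⟩
    pow (first T) (suc r) ++ third T
      ≡⟨ cong (λ T → pow (first T) (suc r) ++ third T) (tripleAt-odd m 1≤m) ⟩
    pow (middle (tripleAt m)) (suc r) ++ third (tripleAt m)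
      ≡⟨ cong₂ (λ P Q → pow P (suc r) ++ Q) (middle-tripleAt m 1≤m) (third-tripleAt m 1≤m) ⟩
    pow (S A B (suc m)) (suc r) ++ S A B (a (suc m))   ∎
    where T = tripleAt (suc (m * 2))

lemma2p17 : (A B : List ℤ) (k : ℕ) → 0 < k → ¬ (Σ ℕ (λ t → k ≡ 2 * t))
    → (i : ℕ) → 2 ≤ i → (kk : ℕ → ℕ) → kk 1 ≡ k
    → (∀ j → 2 ≤ j → j ≤ i → 0 < kk j × 2 * kk j ≡ kk (j ∸ 1) + 1)
    → Σ ℕ (λ t → kk i ≡ 2 * t)
    → (2 < kk i → S A B k ≡ pow (S A B (kk i / 2)) i ++ S A B (a (kk i / 2)))
      × (kk i ≡ 2 → S A B k ≡ pow (S A B 0) i ++ S A B 1)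
lemma2p17 A B (suc k) _ _ (suc r) 2≤i kk kk1≡k hyp (t , kk≡2t)
  with t | trans kk≡2t (*-comm 2 t)
       | trans (cong (_∸ 1) (sym kk1≡k))
               (∸1-halving-chain kk r (λ j 2≤j j≤i → proj₂ (hyp j 2≤j j≤i)))
... | zero | kk≡0 | _ = ⊥-elim (n≮0 (subst (0 <_) kk≡0 (proj₁ (hyp (suc r) 2≤i ≤-refl))))
... | suc zero | kk≡2 | k≡ rewrite k≡ | kk≡2 =
  (λ 2<2 → ⊥-elim (<-irrefl refl 2<2)) , λ _ → S-1+2^r* A B r 1 (s≤s z≤n)
... | suc (suc m) | kk≡ | k≡ rewrite k≡ | kk≡ | m*n/n≡m (suc (suc m)) 2 {{_}} =
  (λ _ → S-1+2^r*odd A B r (suc m) (s≤s z≤n)) , λ ()
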